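{- Let $q$ be a prime power and $k,s\ge 1$. If there exists a linear code over $\mathbb{F}_q$ of dimension $k$ having exactly $s$ distinct non-zero Hamming weights among its codewords, then there exists a linear code over $\mathbb{F}_q$ of dimension $k+1$ having exactly $s+1$ distinct non-zero Hamming weights among its codewords.
   Context: The Hamming weight of a vector is its number of non-zero coordinates. -}

module Defs where

open import Level using (0ℓ)
open import Data.Nat using (ℕ; zero; suc; _≥_; _^_)
open import Data.Nat.Primality using (Prime)
open import Data.Fin using (Fin)
import Data.Fin as Fin
open import Data.Product using (Σ; ∃; _×_)
open import Data.List using (List; length)
open import Data.List.Membership.Propositional using (_∈_)
open import Data.List.Relation.Unary.Unique.Propositional using (Unique)
open import Relation.Binary.PropositionalEquality using (_≡_)
open import Relation.Nullary using (¬_; Dec; yes; no)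
open import Relation.Binary using (Decidable)
open import Algebra.Bundles using (CommutativeRing)
open import Function.Bundles using (_⇔_)

IsPrimePower : ℕ → Set
IsPrimePower q = Σ ℕ λ p → Σ ℕ λ e → Prime p × e ≥ 1 × q ≡ p ^ e

record FiniteField (q : ℕ) : Set₁ where
  field
    commRing  : CommutativeRing 0ℓ 0ℓ
  open CommutativeRing commRing public
  field
    1≉0       : ¬ (1# ≈ 0#)
    inverse   : ∀ x → ¬ (x ≈ 0#) → Σ Carrier λ y → (x * y) ≈ 1#
    _≈?_      : Decidable _≈_
    enum      : Fin q → Carrier
    enum-inj  : ∀ i j → enum i ≈ enum j → i ≡ j
    enum-surj : ∀ x → Σ (Fin q) λ i → enum i ≈ x

module _ {q : ℕ} (F : FiniteField q) where
  open FiniteField F hiding (zero)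

  ∑ : (m : ℕ) → (Fin m → Carrier) → Carrier
  ∑ zero    f = 0#
  ∑ (suc m) f = f Fin.zero + ∑ m (λ i → f (Fin.suc i))

  weight : (n : ℕ) → (Fin n → Carrier) → ℕ
  weight zero    c = zero
  weight (suc n) c with c Fin.zero ≈? 0#
  ... | yes _ = weight n (λ j → c (Fin.suc j))
  ... | no  _ = suc (weight n (λ j → c (Fin.suc j)))

  -- A linear [n,k] code over F, given by a k × n generator matrix of full
  -- row rank k; the code is the row space of G, of dimension k.
  record LinearCode (n k : ℕ) : Set where
    field
      G : Fin k → Fin n → Carrier

    encode : (Fin k → Carrier) → (Fin n → Carrier)
    encode x j = ∑ k (λ i → x i * G i j)

    IsCodeword : (Fin n → Carrier) → Set
    IsCodeword c = Σ (Fin k → Carrier) λ x → ∀ j → encode x j ≈ c j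

    field
      independent : ∀ x → (∀ j → encode x j ≈ 0#) → ∀ i → x i ≈ 0#

  IsNonzeroWeightOf : {n k : ℕ} → LinearCode n k → ℕ → Set
  IsNonzeroWeightOf {n} C w =
    Σ (Fin n → Carrier) λ c →
      LinearCode.IsCodeword C c × ¬ (∀ j → c j ≈ 0#) × weight n c ≡ w

  HasExactlyWeights : {n k : ℕ} → LinearCode n k → ℕ → Set
  HasExactlyWeights C s =
    Σ (List ℕ) λ ws → length ws ≡ s × Unique ws ×
      (∀ w → (w ∈ ws) ⇔ IsNonzeroWeightOf C w)

  ExistsCode : (k s : ℕ) → Set
  ExistsCode k s = Σ ℕ λ n → Σ (LinearCode n k) λ C → HasExactlyWeights C s

-- From a code C of length n, build the code C′ of length nq + n + 1 spanned by
-- the columns (α, g) for every column g of C and every α ∈ F_q, together with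
-- n + 1 copies of (1, 0). A message (0, x) gives the codeword x·G repeated q
-- times in each coordinate, of weight q·wt(x·G); a message (a, x) with a ≠ 0
-- vanishes exactly once on each block {(α, g) | α ∈ F_q} and nowhere on the
-- n + 1 extra columns, so its weight is n(q − 1) + n + 1 = nq + 1. Since every
-- weight of C is at most n, the value nq + 1 is new, and the weights of C′ are
-- q times those of C together with nq + 1.
module Submission where

open import Defs
open import Data.Nat using (ℕ; zero; suc; _+_; _*_; _≤_; _≥_; z≤n; s≤s)
open import Data.Nat.Properties
  using (+-suc; *-suc; *-cancelˡ-≡; *-monoʳ-≤; 1+n≰n; m≤n⇒m≤1+n)
import Data.Nat.Properties as ℕ
open import Data.Fin using (Fin; zero; suc; _↑ˡ_; _↑ʳ_; splitAt; combine; remQuot)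
open import Data.Fin.Properties using (suc-injective; splitAt-↑ˡ; splitAt-↑ʳ; remQuot-combine)
open import Data.Vec.Functional using (Vector; head; tail) renaming (_∷_ to _∷ᵛ_)
open import Data.Product using (Σ; ∃-syntax; _×_; _,_)
open import Data.Sum using (_⊎_; inj₁; inj₂)
import Data.Sum as Sum
open import Data.List using (List; _∷_; length; map)
open import Data.List.Properties using (length-map)
open import Data.List.Membership.Propositional using (_∈_)
open import Data.List.Membership.Propositional.Properties using (∈-map⁺; ∈-map⁻)
open import Data.List.Relation.Unary.Any using (here; there)
import Data.List.Relation.Unary.All as All
import Data.List.Relation.Unary.All.Properties as All
open import Data.List.Relation.Unary.AllPairs.Core using (_∷_)
open import Data.List.Relation.Unary.Unique.Propositional using (Unique)
import Data.List.Relation.Unary.Unique.Propositional.Properties as Unique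
open import Relation.Nullary using (¬_; yes; no; contradiction)
open import Relation.Binary.PropositionalEquality
  using (_≡_; _≢_; refl; sym; trans; cong; cong₂; subst; module ≡-Reasoning)
open import Function.Base using (_∘_)
open import Function.Bundles using (_⇔_; mk⇔; Equivalence)
open import Function.Definitions using (Injective)

HasExactly : {A : Set} → (A → Set) → ℕ → Set
HasExactly {A} P s = Σ (List A) λ xs → length xs ≡ s × Unique xs × (∀ x → x ∈ xs ⇔ P x)

HasExactly-cons-map : {A : Set} {P R : A → Set} {s : ℕ} (f : A → A) (t : A) →
                      Injective _≡_ _≡_ f → (∀ {x} → P x → f x ≢ t) →
                      (∀ y → R y ⇔ (y ≡ t ⊎ ∃[ x ] P x × y ≡ f x)) →
                      HasExactly P s → HasExactly R (suc s)
HasExactly-cons-map {P = P} {R} f t f-inj f≢t R⇔ (xs , |xs|≡s , unique , xs⇔P) =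
  t ∷ map f xs , cong suc (trans (length-map f xs) |xs|≡s) ,
  All.map⁺ (All.tabulate λ x∈xs t≡fx → f≢t (Equivalence.to (xs⇔P _) x∈xs) (sym t≡fx)) ∷ Unique.map⁺ f-inj unique ,
  λ y → mk⇔ to from
  where
    to : ∀ {y} → y ∈ t ∷ map f xs → R y
    to (here y≡t) = Equivalence.from (R⇔ _) (inj₁ y≡t)
    to (there y∈) with ∈-map⁻ f y∈
    ... | x , x∈xs , y≡fx = Equivalence.from (R⇔ _) (inj₂ (x , Equivalence.to (xs⇔P x) x∈xs , y≡fx))

    from : ∀ {y} → R y → y ∈ t ∷ map f xs
    from {y} Ry with Equivalence.to (R⇔ y) Ry
    ... | inj₁ y≡t = here y≡t
    ... | inj₂ (x , Px , y≡fx) =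
      there (subst (_∈ map f xs) (sym y≡fx) (∈-map⁺ f (Equivalence.from (xs⇔P x) Px)))

module _ {q : ℕ} (F : FiniteField q) where
  open FiniteField F hiding (zero) renaming (_+_ to _+ᶠ_; _*_ to _*ᶠ_; refl to ≈-refl; sym to ≈-sym; trans to ≈-trans)
  open import Algebra.Properties.Ring ring using (+-inverseˡ-unique)
  import Relation.Binary.Reasoning.Setoid setoid as ≈-Reasoning

  ∑-zero : ∀ k {f : Fin k → Carrier} → (∀ i → f i ≈ 0#) → ∑ F k f ≈ 0#
  ∑-zero zero    f≈0 = ≈-refl
  ∑-zero (suc k) f≈0 = ≈-trans (+-cong (f≈0 zero) (∑-zero k (f≈0 ∘ suc))) (+-identityʳ 0#)

  affine-const : ∀ {a} x c → a ≈ 0# → a *ᶠ x +ᶠ c ≈ c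
  affine-const {a} x c a≈0 = begin
    a *ᶠ x +ᶠ c  ≈⟨ +-congʳ (*-congʳ a≈0) ⟩
    0# *ᶠ x +ᶠ c ≈⟨ +-congʳ (zeroˡ x) ⟩
    0# +ᶠ c      ≈⟨ +-identityˡ c ⟩
    c            ∎
    where open ≈-Reasoning

  affine-root : ∀ {a} c → ¬ a ≈ 0# →
                Σ Carrier λ r → a *ᶠ r +ᶠ c ≈ 0# × (∀ x → a *ᶠ x +ᶠ c ≈ 0# → x ≈ r)
  affine-root {a} c a≉0 with inverse a a≉0
  ... | b , ab≈1 = b *ᶠ - c , root , unique
    where
      open ≈-Reasoning
      root : a *ᶠ (b *ᶠ - c) +ᶠ c ≈ 0#
      root = begin
        a *ᶠ (b *ᶠ - c) +ᶠ c ≈⟨ +-congʳ (≈-sym (*-assoc a b (- c))) ⟩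
        a *ᶠ b *ᶠ - c +ᶠ c   ≈⟨ +-congʳ (*-congʳ ab≈1) ⟩
        1# *ᶠ - c +ᶠ c       ≈⟨ +-congʳ (*-identityˡ (- c)) ⟩
        - c +ᶠ c             ≈⟨ -‿inverseˡ c ⟩
        0#                   ∎
      unique : ∀ x → a *ᶠ x +ᶠ c ≈ 0# → x ≈ b *ᶠ - c
      unique x ax+c≈0 = begin
        x             ≈⟨ ≈-sym (*-identityˡ x) ⟩
        1# *ᶠ x       ≈⟨ *-congʳ (≈-trans (≈-sym ab≈1) (*-comm a b)) ⟩
        b *ᶠ a *ᶠ x   ≈⟨ *-assoc b a x ⟩
        b *ᶠ (a *ᶠ x) ≈⟨ *-congˡ (+-inverseˡ-unique (a *ᶠ x) c ax+c≈0) ⟩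
        b *ᶠ - c      ∎

  weight-cong : ∀ n {f g : Fin n → Carrier} → (∀ j → f j ≈ g j) → weight F n f ≡ weight F n g
  weight-cong zero    f≈g = refl
  weight-cong (suc n) {f} {g} f≈g with f zero ≈? 0# | g zero ≈? 0#
  ... | yes _    | yes _    = weight-cong n (f≈g ∘ suc)
  ... | no _     | no _     = cong suc (weight-cong n (f≈g ∘ suc))
  ... | yes f₀≈0 | no g₀≉0  = contradiction (≈-trans (≈-sym (f≈g zero)) f₀≈0) g₀≉0
  ... | no f₀≉0  | yes g₀≈0 = contradiction (≈-trans (f≈g zero) g₀≈0) f₀≉0

  weight-zero : ∀ n {f : Fin n → Carrier} → (∀ j → f j ≈ 0#) → weight F n f ≡ 0
  weight-zero zero    f≈0 = refl
  weight-zero (suc n) {f} f≈0 with f zero ≈? 0#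
  ... | yes _   = weight-zero n (f≈0 ∘ suc)
  ... | no f₀≉0 = contradiction (f≈0 zero) f₀≉0

  weight≡0⇒zero : ∀ n {f : Fin n → Carrier} → weight F n f ≡ 0 → ∀ j → f j ≈ 0#
  weight≡0⇒zero (suc n) {f} wt≡0 j with f zero ≈? 0#
  weight≡0⇒zero (suc n) wt≡0 zero    | yes f₀≈0 = f₀≈0
  weight≡0⇒zero (suc n) wt≡0 (suc j) | yes _    = weight≡0⇒zero n wt≡0 j
  weight≡0⇒zero (suc n) ()   j       | no _

  weight-nowhereZero : ∀ n {f : Fin n → Carrier} → (∀ j → ¬ f j ≈ 0#) → weight F n f ≡ n
  weight-nowhereZero zero    f≉0 = refl
  weight-nowhereZero (suc n) {f} f≉0 with f zero ≈? 0#
  ... | yes f₀≈0 = contradiction f₀≈0 (f≉0 zero)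
  ... | no _     = cong suc (weight-nowhereZero n (f≉0 ∘ suc))

  weight-uniqueZero : ∀ n {f : Fin (suc n) → Carrier} j₀ → f j₀ ≈ 0# →
                      (∀ j → f j ≈ 0# → j ≡ j₀) → weight F (suc n) f ≡ n
  weight-uniqueZero n {f} zero f₀≈0 only-j₀ with f zero ≈? 0#
  ... | yes _   = weight-nowhereZero n λ j fj≈0 → contradiction (only-j₀ (suc j) fj≈0) λ ()
  ... | no f₀≉0 = contradiction f₀≈0 f₀≉0
  weight-uniqueZero (suc n) {f} (suc j₀) fj₀≈0 only-j₀ with f zero ≈? 0#
  ... | yes f₀≈0 = contradiction (only-j₀ zero f₀≈0) λ ()
  ... | no _     = cong suc (weight-uniqueZero n j₀ fj₀≈0 λ j fj≈0 → suc-injective (only-j₀ (suc j) fj≈0))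

  weight≤length : ∀ n (f : Fin n → Carrier) → weight F n f ≤ n
  weight≤length zero    f = z≤n
  weight≤length (suc n) f with f zero ≈? 0#
  ... | yes _ = m≤n⇒m≤1+n (weight≤length n (tail f))
  ... | no _  = s≤s (weight≤length n (tail f))

  weight-split : ∀ m p (f : Fin (m + p) → Carrier) →
                 weight F (m + p) f ≡ weight F m (f ∘ (_↑ˡ p)) + weight F p (f ∘ (m ↑ʳ_))
  weight-split zero    p f = refl
  weight-split (suc m) p f with f zero ≈? 0#
  ... | yes _ = weight-split m p (tail f)
  ... | no _  = cong suc (weight-split m p (tail f))

  weight-blocks-const : ∀ n m w (f : Fin (n * m) → Carrier) →
                        (∀ (j : Fin n) → weight F m (λ (l : Fin m) → f (combine j l)) ≡ w) → weight F (n * m) f ≡ n * w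
  weight-blocks-const zero    m w f blocks≡w = refl
  weight-blocks-const (suc n) m w f blocks≡w =
    trans (weight-split m (n * m) f)
          (cong₂ _+_ (blocks≡w zero) (weight-blocks-const n m w (f ∘ (m ↑ʳ_)) (blocks≡w ∘ suc)))

  weight-blocks-repeat : ∀ n m (f : Fin (n * m) → Carrier) (c : Fin n → Carrier) →
                         (∀ (j : Fin n) (l : Fin m) → f (combine j l) ≈ c j) → weight F (n * m) f ≡ m * weight F n c
  weight-blocks-repeat zero    m f c f≈c = sym (ℕ.*-zeroʳ m)
  weight-blocks-repeat (suc n) m f c f≈c with c zero ≈? 0#
  ... | yes c₀≈0 = begin
    weight F (m + n * m) f                                        ≡⟨ weight-split m (n * m) f ⟩
    weight F m (f ∘ (_↑ˡ n * m)) + weight F (n * m) (f ∘ (m ↑ʳ_))  ≡⟨ cong₂ _+_ first rest ⟩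
    m * weight F n (tail c)                                       ∎
    where
      open ≡-Reasoning
      first : weight F m (f ∘ (_↑ˡ n * m)) ≡ 0
      first = weight-zero m λ l → ≈-trans (f≈c zero l) c₀≈0
      rest : weight F (n * m) (f ∘ (m ↑ʳ_)) ≡ m * weight F n (tail c)
      rest = weight-blocks-repeat n m (f ∘ (m ↑ʳ_)) (tail c) (f≈c ∘ suc)
  ... | no c₀≉0 = begin
    weight F (m + n * m) f                                        ≡⟨ weight-split m (n * m) f ⟩
    weight F m (f ∘ (_↑ˡ n * m)) + weight F (n * m) (f ∘ (m ↑ʳ_))  ≡⟨ cong₂ _+_ first rest ⟩
    m + m * weight F n (tail c)                                   ≡⟨ sym (*-suc m _) ⟩
    m * suc (weight F n (tail c))                                 ∎
    where
      open ≡-Reasoning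
      first : weight F m (f ∘ (_↑ˡ n * m)) ≡ m
      first = weight-nowhereZero m λ l fl≈0 → c₀≉0 (≈-trans (≈-sym (f≈c zero l)) fl≈0)
      rest : weight F (n * m) (f ∘ (m ↑ʳ_)) ≡ m * weight F n (tail c)
      rest = weight-blocks-repeat n m (f ∘ (m ↑ʳ_)) (tail c) (f≈c ∘ suc)

  module _ {n k : ℕ} (C : LinearCode F n k) where
    open LinearCode C

    IsNonzeroWeightOf⇔ : ∀ w → IsNonzeroWeightOf F C w ⇔ (∃[ x ] weight F n (encode x) ≡ w × w ≢ 0)
    IsNonzeroWeightOf⇔ w = mk⇔ to from
      where
        to : IsNonzeroWeightOf F C w → ∃[ x ] weight F n (encode x) ≡ w × w ≢ 0
        to (c , (x , x·G≈c) , c≉0 , wt≡w) =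
          x , trans (weight-cong n x·G≈c) wt≡w , λ w≡0 → c≉0 (weight≡0⇒zero n (trans wt≡w w≡0))
        from : ∃[ x ] weight F n (encode x) ≡ w × w ≢ 0 → IsNonzeroWeightOf F C w
        from (x , wt≡w , w≢0) =
          encode x , (x , λ _ → ≈-refl) , (λ x·G≈0 → w≢0 (trans (sym wt≡w) (weight-zero n x·G≈0))) , wt≡w

    nonzeroWeight≤length : ∀ {w} → IsNonzeroWeightOf F C w → w ≤ n
    nonzeroWeight≤length (c , _ , _ , refl) = weight≤length n c

module _ {q-1 : ℕ} (F : FiniteField (suc q-1)) where
  open FiniteField F hiding (zero) renaming (_+_ to _+ᶠ_; _*_ to _*ᶠ_; refl to ≈-refl; sym to ≈-sym; trans to ≈-trans)

  private
    q : ℕ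
    q = suc q-1

  weight-affine : ∀ {a} c → ¬ a ≈ 0# → weight F q (λ l → a *ᶠ enum l +ᶠ c) ≡ q-1
  weight-affine c a≉0 with affine-root F c a≉0
  ... | r , root , unique with enum-surj r
  ... | l₀ , l₀↦r = weight-uniqueZero F q-1 l₀ (≈-trans (+-congʳ (*-congˡ l₀↦r)) root)
                      λ l al+c≈0 → enum-inj l l₀ (≈-trans (unique (enum l) al+c≈0) (≈-sym l₀↦r))

  module Extension {n k : ℕ} (C : LinearCode F n k) where
    open LinearCode C

    length′ : ℕ
    length′ = n * q + suc n

    Column : Set
    Column = (Fin n × Fin q) ⊎ Fin (suc n)

    label : Fin length′ → Column
    label j = Sum.map₁ (remQuot q) (splitAt (n * q) j)

    label-block : ∀ j l → label (combine j l ↑ˡ suc n) ≡ inj₁ (j , l)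
    label-block j l =
      trans (cong (Sum.map₁ (remQuot q)) (splitAt-↑ˡ (n * q) (combine j l) (suc n)))
            (cong inj₁ (remQuot-combine j l))

    label-extra : ∀ t → label (n * q ↑ʳ t) ≡ inj₂ t
    label-extra t = cong (Sum.map₁ (remQuot q)) (splitAt-↑ʳ (n * q) (suc n) t)

    column : Column → Vector Carrier (suc k)
    column (inj₁ (j , l)) = enum l ∷ᵛ λ i → G i j
    column (inj₂ _)       = 1# ∷ᵛ λ _ → 0#

    encodeColumn : Vector Carrier (suc k) → Column → Carrier
    encodeColumn y u = ∑ F (suc k) λ i → y i *ᶠ column u i

    encodeColumn-block : ∀ y j l → encodeColumn y (label (combine j l ↑ˡ suc n)) ≈ head y *ᶠ enum l +ᶠ encode (tail y) j
    encodeColumn-block y j l = reflexive (cong (encodeColumn y) (label-block j l))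

    encodeColumn-extra : ∀ y t → encodeColumn y (label (n * q ↑ʳ t)) ≈ head y
    encodeColumn-extra y t rewrite label-extra t =
      ≈-trans (+-cong (*-identityʳ (head y)) (∑-zero F k λ i → zeroʳ (tail y i))) (+-identityʳ (head y))

    encode-independent : ∀ y → (∀ j → encodeColumn y (label j) ≈ 0#) → ∀ i → y i ≈ 0#
    encode-independent y y·G′≈0 = go
      where
        y₀≈0 : head y ≈ 0#
        y₀≈0 = ≈-trans (≈-sym (encodeColumn-extra y zero)) (y·G′≈0 _)
        tail≈0 : ∀ j → encode (tail y) j ≈ 0#
        tail≈0 j = ≈-trans (≈-sym (affine-const F (enum zero) _ y₀≈0))
                           (≈-trans (≈-sym (encodeColumn-block y j zero)) (y·G′≈0 _))
        go : ∀ i → y i ≈ 0#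
        go zero    = y₀≈0
        go (suc i) = independent (tail y) tail≈0 i

    extension : LinearCode F length′ (suc k)
    extension = record { G = λ i j → column (label j) i ; independent = encode-independent }

    open LinearCode extension using () renaming (encode to encode′)

    blocksWeight extrasWeight : Vector Carrier (suc k) → ℕ
    blocksWeight y = weight F (n * q) (encode′ y ∘ (_↑ˡ suc n))
    extrasWeight y = weight F (suc n) (encode′ y ∘ (n * q ↑ʳ_))

    weight-encode′ : ∀ y → weight F length′ (encode′ y) ≡ blocksWeight y + extrasWeight y
    weight-encode′ y = weight-split F (n * q) (suc n) (encode′ y)

    weight-encode′-head≈0 : ∀ y → head y ≈ 0# → weight F length′ (encode′ y) ≡ q * weight F n (encode (tail y))
    weight-encode′-head≈0 y y₀≈0 = begin
      weight F length′ (encode′ y)          ≡⟨ weight-encode′ y ⟩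
      blocksWeight y + extrasWeight y       ≡⟨ cong₂ _+_ blocks extras ⟩
      q * weight F n (encode (tail y)) + 0  ≡⟨ ℕ.+-identityʳ _ ⟩
      q * weight F n (encode (tail y))      ∎
      where
        open ≡-Reasoning
        blocks : blocksWeight y ≡ q * weight F n (encode (tail y))
        blocks = weight-blocks-repeat F n q _ (encode (tail y))
                   λ j l → ≈-trans (encodeColumn-block y j l) (affine-const F (enum l) _ y₀≈0)
        extras : extrasWeight y ≡ 0
        extras = weight-zero F (suc n) λ t → ≈-trans (encodeColumn-extra y t) y₀≈0

    weight-encode′-head≉0 : ∀ y → ¬ head y ≈ 0# → weight F length′ (encode′ y) ≡ suc (q * n)
    weight-encode′-head≉0 y y₀≉0 = begin
      weight F length′ (encode′ y)    ≡⟨ weight-encode′ y ⟩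
      blocksWeight y + extrasWeight y ≡⟨ cong₂ _+_ blocks extras ⟩
      n * q-1 + suc n                 ≡⟨ +-suc (n * q-1) n ⟩
      suc (n * q-1 + n)               ≡⟨ cong suc (ℕ.+-comm (n * q-1) n) ⟩
      suc (n + n * q-1)               ≡⟨ cong (λ m → suc (n + m)) (ℕ.*-comm n q-1) ⟩
      suc (q * n)                     ∎
      where
        open ≡-Reasoning
        blocks : blocksWeight y ≡ n * q-1
        blocks = weight-blocks-const F n q q-1 _ λ j →
          trans (weight-cong F q (encodeColumn-block y j)) (weight-affine (encode (tail y) j) y₀≉0)
        extras : extrasWeight y ≡ suc n
        extras = weight-nowhereZero F (suc n) λ t yt≈0 → y₀≉0 (≈-trans (≈-sym (encodeColumn-extra y t)) yt≈0)

    nonzeroWeight-extension⇔ : ∀ w → IsNonzeroWeightOf F extension w ⇔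
                               (w ≡ suc (q * n) ⊎ ∃[ v ] IsNonzeroWeightOf F C v × w ≡ q * v)
    nonzeroWeight-extension⇔ w = mk⇔ to from
      where
        to : IsNonzeroWeightOf F extension w → w ≡ suc (q * n) ⊎ ∃[ v ] IsNonzeroWeightOf F C v × w ≡ q * v
        to cw with Equivalence.to (IsNonzeroWeightOf⇔ F extension w) cw
        ... | y , wt≡w , w≢0 with head y ≈? 0#
        ... | no y₀≉0  = inj₁ (trans (sym wt≡w) (weight-encode′-head≉0 y y₀≉0))
        ... | yes y₀≈0 = inj₂ (_ , Equivalence.from (IsNonzeroWeightOf⇔ F C _) (tail y , refl , v≢0) , w≡qv)
          where
            w≡qv : w ≡ q * weight F n (encode (tail y))
            w≡qv = trans (sym wt≡w) (weight-encode′-head≈0 y y₀≈0)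
            v≢0 : weight F n (encode (tail y)) ≢ 0
            v≢0 v≡0 = w≢0 (trans w≡qv (trans (cong (q *_) v≡0) (ℕ.*-zeroʳ q)))
        from : w ≡ suc (q * n) ⊎ ∃[ v ] IsNonzeroWeightOf F C v × w ≡ q * v → IsNonzeroWeightOf F extension w
        from (inj₁ refl) = Equivalence.from (IsNonzeroWeightOf⇔ F extension _)
          (1# ∷ᵛ (λ _ → 0#) , weight-encode′-head≉0 (1# ∷ᵛ λ _ → 0#) 1≉0 , λ ())
        from (inj₂ (v , cv , refl)) with Equivalence.to (IsNonzeroWeightOf⇔ F C v) cv
        ... | x , wt≡v , v≢0 = Equivalence.from (IsNonzeroWeightOf⇔ F extension _)
          (0# ∷ᵛ x , trans (weight-encode′-head≈0 (0# ∷ᵛ x) ≈-refl) (cong (q *_) wt≡v) ,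
           λ qv≡0 → v≢0 (*-cancelˡ-≡ v 0 q (trans qv≡0 (sym (ℕ.*-zeroʳ q)))))

    scaledWeight≢top : ∀ {v} → IsNonzeroWeightOf F C v → q * v ≢ suc (q * n)
    scaledWeight≢top cv qv≡top = 1+n≰n (subst (_≤ q * n) qv≡top (*-monoʳ-≤ q (nonzeroWeight≤length F C cv)))

lemma3 : (q : ℕ) → IsPrimePower q → (F : FiniteField q) →
           (k s : ℕ) → k ≥ 1 → s ≥ 1 →
           ExistsCode F k s → ExistsCode F (suc k) (suc s)
lemma3 zero       _ F k s _ _ _ with FiniteField.enum-surj F (FiniteField.0# F)
... | () , _
lemma3 (suc q-1) _ F k s _ _ (n , C , weights) =
  length′ , extension ,
  HasExactly-cons-map (q *_) (suc (q * n)) (λ {v} {w} → *-cancelˡ-≡ v w q)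
                      scaledWeight≢top nonzeroWeight-extension⇔ weights
  where
    q : ℕ
    q = suc q-1
    open Extension F C
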